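{- Let $G$ be a finite group. Then the power graph $\mathcal P_G$ is isomorphic to the generalized lexicographic product $\mathcal I_G[\mathbb K_G]$.
   Context: The power graph $\mathcal P_G$ has vertex set $G$, two distinct elements adjacent iff one is a power of the other. Let $\mathcal C(G)$ be the set of cyclic subgroups of $G$. $\mathcal I_G$ is the graph on $\mathcal C(G)$ in which two distinct cyclic subgroups are adjacent iff one contains the other. For $C\in\mathcal C(G)$, $\mathcal K_C$ is the complete graph on $\varphi(|C|)$ vertices ($\varphi$ Euler's totient), and $\mathbb K_G=\{\mathcal K_C: C\in\mathcal C(G)\}$. For a graph $\mathcal H$ and a family $\{\mathcal F_v: v\in V(\mathcal H)\}$ of graphs, the generalized lexicographic product $\mathcal H[\{\mathcal F_v\}]$ has vertex set $\{(v,w): v\in V(\mathcal H), w\in V(\mathcal F_v)\}$, and $(v_1,w_1),(v_2,w_2)$ are adjacent iff $\{v_1,v_2\}\in E(\mathcal H)$, or $v_1=v_2$ and $\{w_1,w_2\}\in E(\mathcal F_{v_1})$. -}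

module Defs where

open import Data.Nat using (ℕ; zero; suc)
open import Data.Nat.GCD using (gcd)
open import Data.Fin using (Fin)
open import Data.Fin.Subset using (Subset; _∈_; _⊆_; ∣_∣)
open import Data.List using (List; length; filter; map; upTo)
open import Data.Product using (Σ; ∃; _×_; _,_)
open import Data.Sum using (_⊎_)
open import Relation.Nullary using (¬_)
open import Relation.Binary.PropositionalEquality using (_≡_; subst)
open import Algebra.Core using (Op₁; Op₂)
open import Algebra.Structures using (IsGroup)
open import Function.Bundles using (_⇔_; _↔_; Inverse)

record Graph : Set₁ where
  field
    V   : Set
    Adj : V → V → Set

open Graph public

record _≅_ (H K : Graph) : Set where
  field
    bij      : V H ↔ V K
    adj-pres : ∀ a b → Adj H a b ⇔ Adj K (Inverse.to bij a) (Inverse.to bij b)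

Complete : ℕ → Graph
Complete m = record { V = Fin m ; Adj = λ w₁ w₂ → ¬ (w₁ ≡ w₂) }

Lex : (H : Graph) → (V H → Graph) → Graph
Lex H F = record
  { V   = Σ (V H) (λ v → V (F v))
  ; Adj = λ { (v₁ , w₁) (v₂ , w₂) →
              Adj H v₁ v₂
              ⊎ Σ (v₁ ≡ v₂) (λ p → Adj (F v₂) (subst (λ v → V (F v)) p w₁) w₂) } }

φ : ℕ → ℕ
φ m = length (filter (λ k → gcd k m Data.Nat.≟ 1) (map suc (upTo m)))

record FiniteGroup : Set where
  field
    n       : ℕ
    _∙_     : Op₂ (Fin n)
    ε       : Fin n
    _⁻¹     : Op₁ (Fin n)
    isGroup : IsGroup _≡_ _∙_ ε _⁻¹

module _ (G : FiniteGroup) where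
  open FiniteGroup G

  pow : Fin n → ℕ → Fin n
  pow x zero    = ε
  pow x (suc k) = x ∙ pow x k

  PowerGraph : Graph
  PowerGraph = record
    { V   = Fin n
    ; Adj = λ x y → ¬ (x ≡ y) × ((∃ λ k → pow x k ≡ y) ⊎ (∃ λ k → pow y k ≡ x)) }

  -- a cyclic subgroup, given by its set of elements; the witness
  -- generator is irrelevant so equal subsets give equal subgroups
  record CyclicSubgroup : Set where
    constructor cyc
    field
      elems  : Subset n
      .isCyc : ∃ λ x → ∀ y → (y ∈ elems) ⇔ (∃ λ k → pow x k ≡ y)

  open CyclicSubgroup public

  InclusionGraph : Graph
  InclusionGraph = record
    { V   = CyclicSubgroup
    ; Adj = λ C₁ C₂ → ¬ (C₁ ≡ C₂) × (elems C₁ ⊆ elems C₂ ⊎ elems C₂ ⊆ elems C₁) }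

  𝕂 : CyclicSubgroup → Graph
  𝕂 C = Complete (φ ∣ elems C ∣)

-- x and y are adjacent in the power graph exactly when x ≠ y and the cyclic
-- subgroups ⟨x⟩ and ⟨y⟩ are comparable under inclusion.  The elements with
-- ⟨y⟩ = C are the generators g^k of C = ⟨g⟩ with gcd(k, |C|) = 1, so there are
-- φ(|C|) of them and they are pairwise adjacent.  Grouping the elements of G by
-- the cyclic subgroup they generate therefore identifies P_G with I_G[𝕂_G].
module Submission where

open import Data.Nat using (ℕ; zero; suc; _+_; _*_; _∸_; _<_; _≤_; z≤n; s≤s)
import Data.Nat
open import Data.Nat.Properties
  using ( ≤-antisym; ≤-refl; <⇒≤; ≤-<-trans; <-cmp; n<1+n; m<1+n⇒m<n∨m≡n; suc-injective
        ; +-suc; +-identityʳ; *-suc; *-zeroʳ; *-comm; m∸n≤m; m<n⇒0<n∸m; m+[n∸m]≡n )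
open import Data.Nat.DivMod using (_%_; _/_; m%n<n; m≡m%n+[m/n]*n)
open import Data.Nat.Divisibility
  using (_∣_; ∣-trans; ∣1⇒≡1; ∣m∣n⇒∣m+n; ∣m⇒∣m*n; n∣m*n; %-presˡ-∣)
open import Data.Nat.GCD using (gcd; GCD; gcd-GCD; module Bézout; gcd[m,n]∣m; gcd[m,n]∣n)
open import Data.Nat.Tactic.RingSolver using (solve-∀)
open import Data.Fin using (Fin; zero; suc; toℕ; fromℕ<)
open import Data.Fin.Properties
  using (injective⇒≤; pigeonhole; any?; toℕ-injective; toℕ<n; toℕ-fromℕ<)
  renaming (_≟_ to _≟ᶠ_)
import Data.Fin.Properties as Fin
open import Data.Fin.Subset using (Subset; inside; outside; _∈_; _⊆_; ∣_∣)
open import Data.Fin.Subset.Properties using (drop-there; ⊆-antisym; ⊆-reflexive)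
open import Data.Vec using ([]; _∷_; here; there; tabulate)
open import Data.Vec.Properties using (lookup∘tabulate; []=⇒lookup; lookup⇒[]=; ≡-dec)
import Data.Bool.Properties as Bool
open import Data.List as List using (List; lookup)
import Data.List.Relation.Unary.All as All
open import Data.List.Relation.Unary.AllPairs using (_∷_)
open import Data.List.Relation.Unary.Unique.Propositional using (Unique)
open import Data.List.Relation.Unary.Unique.Propositional.Properties using (filter⁺; map⁺; upTo⁺)
import Data.List.Relation.Unary.Any as Any
open import Data.List.Relation.Unary.Any.Properties using (lookup-index)
open import Data.List.Membership.Propositional using () renaming (_∈_ to _∈ₗ_)
open import Data.List.Membership.Propositional.Properties
  using (∈-lookup; ∈-filter⁻; ∈-filter⁺; ∈-map⁻; ∈-map⁺; ∈-upTo⁻; ∈-upTo⁺)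
open import Data.Product using (Σ; ∃; _×_; _,_; proj₁; proj₂)
open import Data.Sum as Sum using (_⊎_; inj₁; inj₂; [_,_]′)
import Data.Empty.Irrelevant as Irrelevant
open import Function using (_∘_)
open import Function.Bundles using (_⇔_; mk⇔; Equivalence; _↔_; mk↔ₛ′)
open import Function.Properties.Equivalence using () renaming (sym to ⇔-sym; trans to ⇔-trans)
open import Relation.Nullary using (¬_; Dec; yes; no; does; contradiction)
import Relation.Nullary.Decidable as Dec
open import Relation.Nullary.Reflects using (Reflects; invert)
open import Relation.Unary using (Decidable)
open import Relation.Binary.Definitions using (tri<; tri≈; tri>)
open import Relation.Binary.PropositionalEquality
  using (_≡_; refl; sym; trans; cong; subst; module ≡-Reasoning)
open import Algebra.Structures using (IsGroup)
open import Algebra.Bundles using (Group)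
import Algebra.Properties.Group as GroupProperties

open import Defs

open ≡-Reasoning
open Equivalence using (to; from)

LeastWitness : (ℕ → Set) → Set
LeastWitness P = ∃ λ m → P m × (∀ {k} → k < m → ¬ P k)

least-witness-below : {P : ℕ → Set} → Decidable P → ∀ b → LeastWitness P ⊎ (∀ {k} → k < b → ¬ P k)
least-witness-below P? zero = inj₂ λ ()
least-witness-below P? (suc b) with least-witness-below P? b | P? b
... | inj₁ least | _      = inj₁ least
... | inj₂ none  | yes pb = inj₁ (b , pb , none)
... | inj₂ none  | no ¬pb = inj₂ λ k<1+b → [ none , (λ { refl → ¬pb }) ]′ (m<1+n⇒m<n∨m≡n k<1+b)

least-witness : {P : ℕ → Set} → Decidable P → ∃ P → LeastWitness P
least-witness P? (m , pm) with least-witness-below P? (suc m)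
... | inj₁ least = least
... | inj₂ none  = contradiction pm (none (n<1+n m))

subsetOf : ∀ {n} {P : Fin n → Set} → Decidable P → Subset n
subsetOf P? = tabulate (does ∘ P?)

∈-subsetOf⇔ : ∀ {n} {P : Fin n → Set} (P? : Decidable P) {x} → x ∈ subsetOf P? ⇔ P x
∈-subsetOf⇔ P? {x} = mk⇔
  (λ x∈ → invert (subst (Reflects _) (trans (sym (lookup∘tabulate _ x)) ([]=⇒lookup x∈))
                                     (Dec.proof (P? x))))
  (λ px → lookup⇒[]= x _ (trans (lookup∘tabulate _ x) (Dec.dec-true (P? x) px)))

record Enumeration {A : Set} (P : A → Set) (m : ℕ) : Set where
  field
    enum      : Fin m → A
    injective : ∀ {i j} → enum i ≡ enum j → i ≡ j
    into      : ∀ i → P (enum i)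
    onto      : ∀ {x} → P x → ∃ λ i → enum i ≡ x

open Enumeration

Enumeration-≤ : ∀ {A} {P : A → Set} {m m′} → Enumeration P m → Enumeration P m′ → m ≤ m′
Enumeration-≤ E E′ = injective⇒≤ {f = λ i → proj₁ (onto E′ (into E i))} λ {i} {j} eq →
  injective E (trans (sym (proj₂ (onto E′ (into E i))))
              (trans (cong (enum E′) eq) (proj₂ (onto E′ (into E j)))))

Enumeration-unique : ∀ {A} {P : A → Set} {m m′} → Enumeration P m → Enumeration P m′ → m ≡ m′
Enumeration-unique E E′ = ≤-antisym (Enumeration-≤ E E′) (Enumeration-≤ E′ E)

Enumeration-resp : ∀ {A} {P Q : A → Set} {m} → (∀ {x} → P x → Q x) → (∀ {x} → Q x → P x) →
                   Enumeration P m → Enumeration Q m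
Enumeration-resp P⇒Q Q⇒P E = record
  { enum = enum E ; injective = injective E ; into = P⇒Q ∘ into E ; onto = onto E ∘ Q⇒P }

Enumeration-suc : ∀ {n m} {P : Fin (suc n) → Set} →
                  ¬ P zero → Enumeration (P ∘ suc) m → Enumeration P m
Enumeration-suc ¬P0 E = record
  { enum      = suc ∘ enum E
  ; injective = injective E ∘ Fin.suc-injective
  ; into      = into E
  ; onto      = λ { {zero} p0 → contradiction p0 ¬P0
                  ; {suc x} px → let i , eq = onto E px in i , cong suc eq } }

Enumeration-cons : ∀ {n m} {P : Fin (suc n) → Set} →
                   P zero → Enumeration (P ∘ suc) m → Enumeration P (suc m)
Enumeration-cons {P = P} P0 E = record
  { enum = enum′ ; injective = injective′ ; into = into′ ; onto = onto′ }
  where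
  enum′ : Fin (suc _) → Fin (suc _)
  enum′ zero    = zero
  enum′ (suc i) = suc (enum E i)
  injective′ : ∀ {i j} → enum′ i ≡ enum′ j → i ≡ j
  injective′ {zero}  {zero}  _  = refl
  injective′ {zero}  {suc _} ()
  injective′ {suc _} {zero}  ()
  injective′ {suc i} {suc j} eq = cong suc (injective E (Fin.suc-injective eq))
  into′ : ∀ i → P (enum′ i)
  into′ zero    = P0
  into′ (suc i) = into E i
  onto′ : ∀ {x} → P x → ∃ λ i → enum′ i ≡ x
  onto′ {zero}  _  = zero , refl
  onto′ {suc x} px = let i , eq = onto E px in suc i , cong suc eq

∈-Enumeration : ∀ {n} (s : Subset n) → Enumeration (_∈ s) ∣ s ∣
∈-Enumeration []            =
  record { enum = λ () ; injective = λ { {()} } ; into = λ () ; onto = λ { {()} } }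
∈-Enumeration (outside ∷ s) = Enumeration-suc (λ ()) (Enumeration-resp there drop-there (∈-Enumeration s))
∈-Enumeration (inside ∷ s)  = Enumeration-cons here (Enumeration-resp there drop-there (∈-Enumeration s))

lookup-injective : ∀ {A : Set} {xs : List A} → Unique xs →
                   ∀ {i j} → lookup xs i ≡ lookup xs j → i ≡ j
lookup-injective (_   ∷ _) {zero}  {zero}  _  = refl
lookup-injective (x∉ ∷ _) {zero}  {suc j} eq = contradiction eq (All.lookup x∉ (∈-lookup j))
lookup-injective (x∉ ∷ _) {suc i} {zero}  eq = contradiction (sym eq) (All.lookup x∉ (∈-lookup i))
lookup-injective (_   ∷ u) {suc i} {suc j} eq = cong suc (lookup-injective u eq)

Unique-Enumeration : ∀ {A : Set} {xs : List A} → Unique xs → Enumeration (_∈ₗ xs) (List.length xs)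
Unique-Enumeration {xs = xs} u = record
  { enum      = lookup xs
  ; injective = lookup-injective u
  ; into      = ∈-lookup
  ; onto      = λ x∈ → Any.index x∈ , sym (lookup-index x∈) }

Totative : ℕ → ℕ → Set
Totative o k = 0 < k × k ≤ o × gcd k o ≡ 1

Totative-Enumeration : ∀ o → Enumeration (Totative o) (φ o)
Totative-Enumeration o =
  Enumeration-resp totative totative⁻¹
    (Unique-Enumeration (filter⁺ coprime? (map⁺ suc-injective (upTo⁺ o))))
  where
  coprime? : ∀ k → Dec (gcd k o ≡ 1)
  coprime? k = gcd k o Data.Nat.≟ 1
  totatives : List ℕ
  totatives = List.filter coprime? (List.map suc (List.upTo o))
  totative : ∀ {k} → k ∈ₗ totatives → Totative o k
  totative k∈ with ∈-filter⁻ coprime? {xs = List.map suc (List.upTo o)} k∈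
  ... | k∈′ , coprime with ∈-map⁻ suc k∈′
  ... | j , j∈ , refl = s≤s z≤n , ∈-upTo⁻ j∈ , coprime
  totative⁻¹ : ∀ {k} → Totative o k → k ∈ₗ totatives
  totative⁻¹ {suc k} (_ , k<o , coprime) = ∈-filter⁺ coprime? (∈-map⁺ suc (∈-upTo⁺ k<o)) coprime

BlowupAdj : (H : Graph) {A : Set} → (A → V H) → A → A → Set
BlowupAdj H c x y = Adj H (c x) (c y) ⊎ (c x ≡ c y × ¬ x ≡ y)

module _ {P H : Graph} {m : V H → ℕ} (c : V P → V H)
         (fibre : ∀ h → Enumeration (λ x → c x ≡ h) (m h)) where

  index : ∀ x → Fin (m (c x))
  index x = proj₁ (onto (fibre (c x)) refl)

  enum-index : ∀ x → enum (fibre (c x)) (index x) ≡ x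
  enum-index x = proj₂ (onto (fibre (c x)) refl)

  index-enum : ∀ h i → (c (enum (fibre h) i) , index (enum (fibre h) i)) ≡ (h , i)
  index-enum h i = go refl (into (fibre h) i)
    where
    go : ∀ {h′} (p : c (enum (fibre h) i) ≡ h′) → h′ ≡ h →
         (h′ , proj₁ (onto (fibre h′) p)) ≡ (h , i)
    go p refl = cong (h ,_) (injective (fibre h) (proj₂ (onto (fibre h) p)))

  fibres↔ : V P ↔ Σ (V H) (Fin ∘ m)
  fibres↔ = mk↔ₛ′ (λ x → c x , index x) (λ (h , i) → enum (fibre h) i)
                  (λ (h , i) → index-enum h i) enum-index

  enum-subst : ∀ {h h′} (p : h ≡ h′) i → enum (fibre h′) (subst (Fin ∘ m) p i) ≡ enum (fibre h) i
  enum-subst refl i = refl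

  subst-index≡⇔ : ∀ {x y} (p : c x ≡ c y) → subst (Fin ∘ m) p (index x) ≡ index y ⇔ x ≡ y
  subst-index≡⇔ {x} {y} p = mk⇔ index≡⇒≡ (≡⇒index≡ p)
    where
    index≡⇒≡ : subst (Fin ∘ m) p (index x) ≡ index y → x ≡ y
    index≡⇒≡ eq = begin
      x                                                ≡⟨ enum-index x ⟨
      enum (fibre (c x)) (index x)                     ≡⟨ enum-subst p (index x) ⟨
      enum (fibre (c y)) (subst (Fin ∘ m) p (index x)) ≡⟨ cong (enum (fibre (c y))) eq ⟩
      enum (fibre (c y)) (index y)                     ≡⟨ enum-index y ⟩
      y                                                ∎
    ≡⇒index≡ : ∀ {y} (q : c x ≡ c y) → x ≡ y → subst (Fin ∘ m) q (index x) ≡ index y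
    ≡⇒index≡ refl refl = refl

  Lex-Complete-adjacency⇔ : ∀ x y →
    Adj (Lex H (Complete ∘ m)) (c x , index x) (c y , index y) ⇔ BlowupAdj H c x y
  Lex-Complete-adjacency⇔ x y = mk⇔
    (Sum.map₂ λ (p , ¬≡) → p , ¬≡ ∘ from (subst-index≡⇔ p))
    (Sum.map₂ λ (p , x≢y) → p , x≢y ∘ to (subst-index≡⇔ p))

  ≅-Lex-Complete : (∀ x y → Adj P x y ⇔ BlowupAdj H c x y) → P ≅ Lex H (Complete ∘ m)
  ≅-Lex-Complete adj = record
    { bij      = fibres↔
    ; adj-pres = λ x y → ⇔-trans (adj x y) (⇔-sym (Lex-Complete-adjacency⇔ x y)) }

module _ (G : FiniteGroup) where
  open FiniteGroup G
  open IsGroup isGroup using (assoc; identityˡ; identityʳ)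
  private
    group : Group _ _
    group = record { isGroup = isGroup }
  open GroupProperties group using (∙-cancelˡ)

  infixr 25 _^_
  _^_ : Fin n → ℕ → Fin n
  x ^ k = pow G x k

  ^-distribˡ-+-∙ : ∀ x a b → x ^ (a + b) ≡ x ^ a ∙ x ^ b
  ^-distribˡ-+-∙ x zero    b = sym (identityˡ _)
  ^-distribˡ-+-∙ x (suc a) b = trans (cong (x ∙_) (^-distribˡ-+-∙ x a b)) (sym (assoc x _ _))

  ^-*-assoc : ∀ x a b → (x ^ a) ^ b ≡ x ^ (a * b)
  ^-*-assoc x a zero    = cong (x ^_) (sym (*-zeroʳ a))
  ^-*-assoc x a (suc b) = begin
    x ^ a ∙ (x ^ a) ^ b  ≡⟨ cong (x ^ a ∙_) (^-*-assoc x a b) ⟩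
    x ^ a ∙ x ^ (a * b)  ≡⟨ ^-distribˡ-+-∙ x a (a * b) ⟨
    x ^ (a + a * b)      ≡⟨ cong (x ^_) (*-suc a b) ⟨
    x ^ (a * suc b)      ∎

  ε^≡ε : ∀ k → ε ^ k ≡ ε
  ε^≡ε zero    = refl
  ε^≡ε (suc k) = trans (cong (ε ∙_) (ε^≡ε k)) (identityˡ ε)

  ^-+-cancelˡ : ∀ x a d → x ^ (a + d) ≡ x ^ a → x ^ d ≡ ε
  ^-+-cancelˡ x a d eq = ∙-cancelˡ (x ^ a) (x ^ d) ε (begin
    x ^ a ∙ x ^ d  ≡⟨ ^-distribˡ-+-∙ x a d ⟨
    x ^ (a + d)    ≡⟨ eq ⟩
    x ^ a          ≡⟨ identityʳ (x ^ a) ⟨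
    x ^ a ∙ ε      ∎)

  ^-periodic : ∀ x → ∃ λ m → x ^ suc m ≡ ε
  ^-periodic x with pigeonhole (n<1+n n) (λ i → x ^ toℕ i)
  ... | i , j , i<j , eq = m , ^-+-cancelˡ x (toℕ i) (suc m) (trans (cong (x ^_) i+m+1≡j) (sym eq))
    where
    m : ℕ
    m = toℕ j ∸ suc (toℕ i)
    i+m+1≡j : toℕ i + suc m ≡ toℕ j
    i+m+1≡j = trans (+-suc (toℕ i) m) (m+[n∸m]≡n i<j)

  private opaque
    minimal-period : ∀ x → LeastWitness (λ m → x ^ suc m ≡ ε)
    minimal-period x = least-witness (λ k → x ^ suc k ≟ᶠ ε) (^-periodic x)

  order : Fin n → ℕ
  order x = suc (proj₁ (minimal-period x))

  ^-order : ∀ x → x ^ order x ≡ ε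
  ^-order x = proj₁ (proj₂ (minimal-period x))

  ^-order-minimal : ∀ x {d} → 0 < d → d < order x → ¬ x ^ d ≡ ε
  ^-order-minimal x {suc d} _ (s≤s d<m) = proj₂ (proj₂ (minimal-period x)) d<m

  ^-+-*order : ∀ x a q → x ^ (a + q * order x) ≡ x ^ a
  ^-+-*order x a q = begin
    x ^ (a + q * order x)      ≡⟨ ^-distribˡ-+-∙ x a (q * order x) ⟩
    x ^ a ∙ x ^ (q * order x)  ≡⟨ cong (λ e → x ^ a ∙ x ^ e) (*-comm q (order x)) ⟩
    x ^ a ∙ x ^ (order x * q)  ≡⟨ cong (x ^ a ∙_) (^-*-assoc x (order x) q) ⟨
    x ^ a ∙ (x ^ order x) ^ q  ≡⟨ cong (λ y → x ^ a ∙ y ^ q) (^-order x) ⟩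
    x ^ a ∙ ε ^ q              ≡⟨ cong (x ^ a ∙_) (ε^≡ε q) ⟩
    x ^ a ∙ ε                  ≡⟨ identityʳ (x ^ a) ⟩
    x ^ a                      ∎

  ^-cong-mod : ∀ x {a b} q r → a + q * order x ≡ b + r * order x → x ^ a ≡ x ^ b
  ^-cong-mod x {a} {b} q r eq = trans (sym (^-+-*order x a q)) (trans (cong (x ^_) eq) (^-+-*order x b r))

  ^-% : ∀ x k → x ^ k ≡ x ^ (k % order x)
  ^-% x k = trans (cong (x ^_) (m≡m%n+[m/n]*n k (order x))) (^-+-*order x (k % order x) (k / order x))

  ^-distinct : ∀ x {i j} → i < j → j < order x → ¬ x ^ i ≡ x ^ j
  ^-distinct x {i} {j} i<j j<o eq = ^-order-minimal x (m<n⇒0<n∸m i<j) (≤-<-trans (m∸n≤m j i) j<o)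
    (^-+-cancelˡ x i (j ∸ i) (trans (cong (x ^_) (m+[n∸m]≡n (<⇒≤ i<j))) (sym eq)))

  ^-injective : ∀ x {i j} → i < order x → j < order x → x ^ i ≡ x ^ j → i ≡ j
  ^-injective x {i} {j} i<o j<o eq with <-cmp i j
  ... | tri< i<j _ _ = contradiction eq (^-distinct x i<j j<o)
  ... | tri≈ _ i≡j _ = i≡j
  ... | tri> _ _ j<i = contradiction (sym eq) (^-distinct x j<i i<o)

  ^-injective-positive : ∀ x {i j} → 0 < i → i ≤ order x → 0 < j → j ≤ order x →
                         x ^ i ≡ x ^ j → i ≡ j
  ^-injective-positive x {suc i} {suc j} _ (s≤s i<o) _ (s≤s j<o) eq =
    cong suc (^-injective x (s≤s i<o) (s≤s j<o) (∙-cancelˡ x _ _ eq))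

  ^-≡⇒%-≡ : ∀ x {a b} → x ^ a ≡ x ^ b → a % order x ≡ b % order x
  ^-≡⇒%-≡ x {a} {b} eq =
    ^-injective x (m%n<n a (order x)) (m%n<n b (order x)) (trans (sym (^-% x a)) (trans eq (^-% x b)))

  ^-positive-exponent : ∀ x j → ∃ λ k → 0 < k × k ≤ order x × x ^ k ≡ x ^ j
  ^-positive-exponent x j with j % order x | ^-% x j | m%n<n j (order x)
  ... | zero  | xʲ≡ε | _   = order x , s≤s z≤n , ≤-refl , trans (^-order x) (sym xʲ≡ε)
  ... | suc r | xʲ≡xʳ | r< = suc r , s≤s z≤n , <⇒≤ r< , sym xʲ≡xʳ

  infix 4 _∈⟨_⟩ _∈⟨?_⟩
  _∈⟨_⟩ : Fin n → Fin n → Set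
  y ∈⟨ x ⟩ = ∃ λ k → x ^ k ≡ y

  ∈⟨⟩-refl : ∀ x → x ∈⟨ x ⟩
  ∈⟨⟩-refl x = 1 , identityʳ x

  ∈⟨⟩-trans : ∀ {x y z} → z ∈⟨ y ⟩ → y ∈⟨ x ⟩ → z ∈⟨ x ⟩
  ∈⟨⟩-trans {x} (b , refl) (a , refl) = a * b , sym (^-*-assoc x a b)

  ∈⟨⟩-below-order : ∀ {x y} → y ∈⟨ x ⟩ → ∃ λ (i : Fin (order x)) → x ^ toℕ i ≡ y
  ∈⟨⟩-below-order {x} (k , eq) =
    fromℕ< k%o<o , trans (cong (x ^_) (toℕ-fromℕ< k%o<o)) (trans (sym (^-% x k)) eq)
    where
    k%o<o : k % order x < order x
    k%o<o = m%n<n k (order x)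

  opaque
    _∈⟨?_⟩ : ∀ y x → Dec (y ∈⟨ x ⟩)
    y ∈⟨? x ⟩ =
      Dec.map′ (λ (i , eq) → toℕ i , eq) ∈⟨⟩-below-order (any? λ i → x ^ toℕ i ≟ᶠ y)

  ⟨_⟩ : Fin n → CyclicSubgroup G
  ⟨ x ⟩ = cyc (subsetOf (_∈⟨? x ⟩)) (x , λ y → ∈-subsetOf⇔ (_∈⟨? x ⟩))

  ∈⟨⟩⇔ : ∀ {x y} → y ∈ elems ⟨ x ⟩ ⇔ y ∈⟨ x ⟩
  ∈⟨⟩⇔ {x} = ∈-subsetOf⇔ (_∈⟨? x ⟩)

  CyclicSubgroup-≡ : ∀ {C D : CyclicSubgroup G} → elems C ≡ elems D → C ≡ D
  CyclicSubgroup-≡ {cyc s _} {cyc .s _} refl = refl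

  _≟ᶜ_ : (C D : CyclicSubgroup G) → Dec (C ≡ D)
  C ≟ᶜ D = Dec.map′ CyclicSubgroup-≡ (cong elems) (≡-dec Bool._≟_ (elems C) (elems D))

  ⟨⟩-⊆⇔ : ∀ {x y} → elems ⟨ x ⟩ ⊆ elems ⟨ y ⟩ ⇔ x ∈⟨ y ⟩
  ⟨⟩-⊆⇔ {x} = mk⇔ (λ ⊆ → to ∈⟨⟩⇔ (⊆ (from ∈⟨⟩⇔ (∈⟨⟩-refl x))))
                  (λ x∈ {_} z∈ → from ∈⟨⟩⇔ (∈⟨⟩-trans (to ∈⟨⟩⇔ z∈) x∈))

  ⟨⟩-≡⇒∈⟨⟩ : ∀ {x y} → ⟨ x ⟩ ≡ ⟨ y ⟩ → x ∈⟨ y ⟩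
  ⟨⟩-≡⇒∈⟨⟩ eq = to ⟨⟩-⊆⇔ (⊆-reflexive (cong elems eq))

  ⟨⟩-≡⇔ : ∀ {x y} → ⟨ x ⟩ ≡ ⟨ y ⟩ ⇔ (x ∈⟨ y ⟩ × y ∈⟨ x ⟩)
  ⟨⟩-≡⇔ = mk⇔ (λ eq → ⟨⟩-≡⇒∈⟨⟩ eq , ⟨⟩-≡⇒∈⟨⟩ (sym eq))
              (λ (x∈ , y∈) → CyclicSubgroup-≡ (⊆-antisym (from ⟨⟩-⊆⇔ x∈) (from ⟨⟩-⊆⇔ y∈)))

  ⟨⟩-generated : ∀ {g C} → (∀ y → y ∈ elems C ⇔ y ∈⟨ g ⟩) → ⟨ g ⟩ ≡ C
  ⟨⟩-generated gen = CyclicSubgroup-≡ (⊆-antisym (λ y∈ → from (gen _) (to ∈⟨⟩⇔ y∈))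
                                                  (λ y∈ → from ∈⟨⟩⇔ (to (gen _) y∈)))

  -- The generator recorded in a cyclic subgroup is irrelevant, so it is found again by search.
  ⟨⟩-surjective : ∀ C → ∃ λ g → ⟨ g ⟩ ≡ C
  ⟨⟩-surjective C@(cyc _ isCyc) with any? (λ g → ⟨ g ⟩ ≟ᶜ C)
  ... | yes found = found
  ... | no none   = Irrelevant.⊥-elim (none (proj₁ isCyc , ⟨⟩-generated (proj₂ isCyc)))

  ⟨⟩-Enumeration : ∀ x → Enumeration (_∈ elems ⟨ x ⟩) (order x)
  ⟨⟩-Enumeration x = record
    { enum      = λ i → x ^ toℕ i
    ; injective = λ {i} {j} → toℕ-injective ∘ ^-injective x (toℕ<n i) (toℕ<n j)
    ; into      = λ i → from ∈⟨⟩⇔ (toℕ i , refl)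
    ; onto      = ∈⟨⟩-below-order ∘ to ∈⟨⟩⇔ }

  ∣⟨⟩∣≡order : ∀ x → ∣ elems ⟨ x ⟩ ∣ ≡ order x
  ∣⟨⟩∣≡order x = Enumeration-unique (∈-Enumeration (elems ⟨ x ⟩)) (⟨⟩-Enumeration x)

  coprime⇒generator : ∀ g k → gcd k (order g) ≡ 1 → g ∈⟨ g ^ k ⟩
  coprime⇒generator g k coprime =
    from-Bézout (Bézout.identity (subst (GCD k (order g)) coprime (gcd-GCD k (order g))))
    where
    m : ℕ
    m = proj₁ (minimal-period g)
    inverse-exponent : ∀ e q r → k * e + q * order g ≡ 1 + r * order g → g ∈⟨ g ^ k ⟩
    inverse-exponent e q r eq = e , trans (^-*-assoc g k e) (trans (^-cong-mod g q r eq) (identityʳ g))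
    from-Bézout : Bézout.Identity 1 k (order g) → g ∈⟨ g ^ k ⟩
    from-Bézout (Bézout.+- x y 1+yo≡xk) =
      inverse-exponent x 0 y (trans (+-identityʳ (k * x)) (trans (*-comm k x) (sym 1+yo≡xk)))
    -- Multiplying 1 + x k = y o by m = o − 1 shows that m x inverts k modulo o.
    from-Bézout (Bézout.-+ x y 1+xk≡yo) = inverse-exponent (m * x) 1 (m * y) (begin
      k * (m * x) + 1 * suc m  ≡⟨ expand m x k ⟩
      m * (1 + x * k) + 1      ≡⟨ cong (λ e → m * e + 1) 1+xk≡yo ⟩
      m * (y * suc m) + 1      ≡⟨ regroup m y ⟩
      1 + m * y * suc m        ∎)
      where
      expand : ∀ m x k → k * (m * x) + 1 * suc m ≡ m * (1 + x * k) + 1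
      expand = solve-∀
      regroup : ∀ m y → m * (y * suc m) + 1 ≡ 1 + m * y * suc m
      regroup = solve-∀

  generator⇒coprime : ∀ g k → g ∈⟨ g ^ k ⟩ → gcd k (order g) ≡ 1
  generator⇒coprime g k (a , gᵏᵃ≡g) =
    ∣1⇒≡1 (subst (d ∣_) (sym (m≡m%n+[m/n]*n 1 o)) d∣1%o+[1/o]*o)
    where
    o d : ℕ
    o = order g
    d = gcd k o
    ka%o≡1%o : (k * a) % o ≡ 1 % o
    ka%o≡1%o =
      ^-≡⇒%-≡ g {k * a} {1} (trans (sym (^-*-assoc g k a)) (trans gᵏᵃ≡g (sym (identityʳ g))))
    d∣1%o+[1/o]*o : d ∣ 1 % o + (1 / o) * o
    d∣1%o+[1/o]*o = ∣m∣n⇒∣m+n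
      (subst (d ∣_) ka%o≡1%o (%-presˡ-∣ (∣m⇒∣m*n a (gcd[m,n]∣m k o)) (gcd[m,n]∣n k o)))
      (∣-trans (gcd[m,n]∣n k o) (n∣m*n (1 / o)))

  generator-Enumeration : ∀ g → Enumeration (λ y → ⟨ y ⟩ ≡ ⟨ g ⟩) (φ (order g))
  generator-Enumeration g = record
    { enum      = λ i → g ^ enum T i
    ; injective = injective′
    ; into      = into′
    ; onto      = onto′ }
    where
    T : Enumeration (Totative (order g)) (φ (order g))
    T = Totative-Enumeration (order g)
    into′ : ∀ i → ⟨ g ^ enum T i ⟩ ≡ ⟨ g ⟩
    into′ i = from ⟨⟩-≡⇔
      ((enum T i , refl) , coprime⇒generator g (enum T i) (proj₂ (proj₂ (into T i))))
    injective′ : ∀ {i j} → g ^ enum T i ≡ g ^ enum T j → i ≡ j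
    injective′ {i} {j} eq with into T i | into T j
    ... | 0<a , a≤o , _ | 0<b , b≤o , _ = injective T (^-injective-positive g 0<a a≤o 0<b b≤o eq)
    onto′ : ∀ {y} → ⟨ y ⟩ ≡ ⟨ g ⟩ → ∃ λ i → g ^ enum T i ≡ y
    onto′ ⟨y⟩≡⟨g⟩ with to ⟨⟩-≡⇔ ⟨y⟩≡⟨g⟩
    ... | (j , refl) , g∈⟨gʲ⟩ with ^-positive-exponent g j
    ... | k , 0<k , k≤o , gᵏ≡gʲ
      with onto T (0<k , k≤o , generator⇒coprime g k (subst (g ∈⟨_⟩) (sym gᵏ≡gʲ) g∈⟨gʲ⟩))
    ...   | i , refl = i , gᵏ≡gʲ

  cyclic-generator-Enumeration : ∀ C → Enumeration (λ y → ⟨ y ⟩ ≡ C) (φ ∣ elems C ∣)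
  cyclic-generator-Enumeration C with ⟨⟩-surjective C
  ... | g , refl =
    subst (λ o → Enumeration (λ y → ⟨ y ⟩ ≡ ⟨ g ⟩) (φ o)) (sym (∣⟨⟩∣≡order g)) (generator-Enumeration g)

  power-adjacency⇔ : ∀ x y → Adj (PowerGraph G) x y ⇔ BlowupAdj (InclusionGraph G) ⟨_⟩ x y
  power-adjacency⇔ x y = mk⇔ to′ from′
    where
    to′ : Adj (PowerGraph G) x y → BlowupAdj (InclusionGraph G) ⟨_⟩ x y
    to′ (x≢y , powers) with ⟨ x ⟩ ≟ᶜ ⟨ y ⟩
    ... | yes ⟨x⟩≡⟨y⟩ = inj₂ (⟨x⟩≡⟨y⟩ , x≢y)
    ... | no  ⟨x⟩≢⟨y⟩ = inj₁ (⟨x⟩≢⟨y⟩ , Sum.swap (Sum.map (from ⟨⟩-⊆⇔) (from ⟨⟩-⊆⇔) powers))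
    from′ : BlowupAdj (InclusionGraph G) ⟨_⟩ x y → Adj (PowerGraph G) x y
    from′ (inj₁ (⟨x⟩≢⟨y⟩ , inclusion)) =
      ⟨x⟩≢⟨y⟩ ∘ cong ⟨_⟩ , Sum.swap (Sum.map (to ⟨⟩-⊆⇔) (to ⟨⟩-⊆⇔) inclusion)
    from′ (inj₂ (⟨x⟩≡⟨y⟩ , x≢y)) = x≢y , inj₁ (proj₂ (to ⟨⟩-≡⇔ ⟨x⟩≡⟨y⟩))

theorem2p17 : (G : FiniteGroup) → PowerGraph G ≅ Lex (InclusionGraph G) (𝕂 G)
theorem2p17 G = ≅-Lex-Complete (⟨_⟩ G) (cyclic-generator-Enumeration G) (power-adjacency⇔ G)
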